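{- Let $\Gamma$ be a finite simple graph. Then the parts (vertices) of the complete skeleton $\Omega(\Gamma)$ are exactly the following: each structural equivalence class of $\Gamma$ that induces a complete subgraph of $\Gamma$ (including singleton classes), and, for each structural equivalence class of size at least two that is an independent set, each of its vertices as a separate singleton part $K_1$ (these $K_1$ parts are pairwise non-adjacent, share the same neighbors, and together form a completely disconnected equivalence class).
   Context: Two vertices $u,v$ of $\Gamma$ are structurally equivalent if the transposition $(u\,v)$ (swapping $u,v$, fixing other vertices) is an automorphism of $\Gamma$; this is an equivalence relation whose classes are the structural equivalence classes. Consider partitions of $V(\Gamma)$ into nonempty parts such that each part induces a complete subgraph of $\Gamma$ and, for any two distinct parts $P,Q$, either every vertex of $P$ is adjacent to every vertex of $Q$ or no vertex of $P$ is adjacent to any vertex of $Q$. The complete skeleton $\Omega(\Gamma)$ is such a partition with the minimum possible number of parts, viewed as a graph whose vertices are the parts (each part of size $a$ labelled $K_a$), two parts being adjacent iff they are completely joined. -}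

module Defs where

open import Data.Nat using (ℕ; _≤_)
open import Data.Fin using (Fin)
open import Data.Bool using (Bool; true; false)
open import Data.Product using (Σ; ∃; _×_; _,_)
open import Data.Sum using (_⊎_)
open import Relation.Nullary using (¬_)
open import Relation.Binary.PropositionalEquality using (_≡_; _≢_)
open import Data.Fin.Permutation.Components using (transpose)

record Graph (n : ℕ) : Set where
  field
    adj     : Fin n → Fin n → Bool
    adj-sym : ∀ x y → adj x y ≡ adj y x
    adj-irr : ∀ x → adj x x ≡ false
open Graph public

module _ {n : ℕ} (Γ : Graph n) where

  StructEquiv : Fin n → Fin n → Set
  StructEquiv u v =
    ∀ x y → adj Γ (transpose u v x) (transpose u v y) ≡ adj Γ x y

  ClassComplete : Fin n → Set
  ClassComplete x =
    ∀ y z → StructEquiv x y → StructEquiv x z → y ≢ z → adj Γ y z ≡ true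

  record SkeletalPartition (k : ℕ) : Set where
    field
      part       : Fin n → Fin k
      nonempty   : ∀ i → ∃ λ x → part x ≡ i
      cliqueParts : ∀ x y → part x ≡ part y → x ≢ y → adj Γ x y ≡ true
      homogeneous : ∀ x x′ y y′ → part x ≡ part x′ → part y ≡ part y′ →
                    part x ≢ part y → adj Γ x y ≡ adj Γ x′ y′
  open SkeletalPartition public

  IsCompleteSkeleton : {k : ℕ} → SkeletalPartition k → Set
  IsCompleteSkeleton {k} _ = ∀ {k′} → SkeletalPartition k′ → k ≤ k′

{-# OPTIONS --safe #-}
module Submission where

open import Defs
open import Data.Nat using (ℕ; zero; suc)
open import Data.Nat.Properties using (1+n≰n)
open import Data.Fin using (Fin; punchOut; punchIn)
open import Data.Fin.Properties
  using (_≟_; punchOut-injective; punchOut-cong; punchOut-punchIn; punchInᵢ≢i)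
open import Data.Fin.Permutation.Components using (transpose)
open import Data.Bool using (true)
open import Data.Product using (_×_; _,_; ∃)
open import Data.Sum using (_⊎_; inj₁; inj₂)
open import Function.Base using (_∘_)
open import Function.Bundles using (_⇔_; mk⇔)
open import Relation.Nullary using (¬_; yes; no; contradiction)
open import Relation.Nullary.Decidable using (dec-true; dec-false)
open import Relation.Binary.PropositionalEquality

-- Structural equivalence of u and v means that u and v have the same
-- neighbours outside {u, v}. Two vertices in the same part of a skeletal
-- partition are therefore adjacent and structurally equivalent, and a class
-- containing an adjacent pair x, y is complete: every other member c of it
-- satisfies adj x c = adj y c = adj c y = adj x y. Conversely, if adjacent
-- structurally equivalent vertices lay in different parts, those two parts
-- could be merged into one clique, giving a skeletal partition with one part
-- fewer and contradicting minimality.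

data Transposition {n : ℕ} (i j : Fin n) : Fin n → Fin n → Set where
  at-i  : Transposition i j i j
  at-j  : Transposition i j j i
  fixed : ∀ {k} → k ≢ i → k ≢ j → Transposition i j k k

transposition : ∀ {n} (i j k : Fin n) → Transposition i j k (transpose i j k)
transposition i j k with k ≟ i | k ≟ j
... | yes refl | _        = at-i
... | no _     | yes refl rewrite dec-true (k ≟ k) refl = at-j
... | no k≢i   | no k≢j   rewrite dec-false (k ≟ j) k≢j = fixed k≢i k≢j

transpose-matchˡ : ∀ {n} (i j : Fin n) → transpose i j i ≡ j
transpose-matchˡ i j with transpose i j i | transposition i j i
... | _ | at-i = refl
... | _ | at-j = refl
... | _ | fixed i≢i _ = contradiction refl i≢i

transpose-fixes : ∀ {n} {i j k : Fin n} → k ≢ i → k ≢ j → transpose i j k ≡ k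
transpose-fixes {i = i} {j} {k} k≢i k≢j with transpose i j k | transposition i j k
... | _ | at-i = contradiction refl k≢i
... | _ | at-j = contradiction refl k≢j
... | _ | fixed _ _ = refl

module Identify {k : ℕ} {P Q : Fin (suc k)} (P≢Q : P ≢ Q) where

  Pair : Fin (suc k) → Set
  Pair i = i ≡ P ⊎ i ≡ Q

  identify : Fin (suc k) → Fin k
  identify i with i ≟ Q
  ... | yes _  = punchOut (P≢Q ∘ sym)
  ... | no i≢Q = punchOut (i≢Q ∘ sym)

  identify-punchIn : ∀ i → identify (punchIn Q i) ≡ i
  identify-punchIn i with punchIn Q i ≟ Q
  ... | yes eq = contradiction eq (punchInᵢ≢i Q i)
  ... | no _   = trans (punchOut-cong Q refl) (punchOut-punchIn Q)

  identify-Q : identify Q ≡ identify P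
  identify-Q with Q ≟ Q | P ≟ Q
  ... | no Q≢Q | _    = contradiction refl Q≢Q
  ... | _ | yes P≡Q  = contradiction P≡Q P≢Q
  ... | yes _ | no _ = punchOut-cong Q refl

  identify-pair : ∀ {i j} → Pair i → Pair j → identify i ≡ identify j
  identify-pair (inj₁ refl) (inj₁ refl) = refl
  identify-pair (inj₁ refl) (inj₂ refl) = sym identify-Q
  identify-pair (inj₂ refl) (inj₁ refl) = identify-Q
  identify-pair (inj₂ refl) (inj₂ refl) = refl

  identify-kernel : ∀ i j → identify i ≡ identify j → i ≡ j ⊎ (Pair i × Pair j)
  identify-kernel i j eq with i ≟ Q | j ≟ Q
  ... | yes i≡Q | yes j≡Q = inj₁ (trans i≡Q (sym j≡Q))
  ... | yes i≡Q | no j≢Q  =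
    inj₂ (inj₂ i≡Q , inj₁ (sym (punchOut-injective (P≢Q ∘ sym) (j≢Q ∘ sym) eq)))
  ... | no i≢Q  | yes j≡Q =
    inj₂ (inj₁ (punchOut-injective (i≢Q ∘ sym) (P≢Q ∘ sym) eq) , inj₂ j≡Q)
  ... | no i≢Q  | no j≢Q  = inj₁ (punchOut-injective (i≢Q ∘ sym) (j≢Q ∘ sym) eq)

module _ {n : ℕ} (Γ : Graph n) where

  SameNeighbours : Fin n → Fin n → Set
  SameNeighbours u v = ∀ w → w ≢ u → w ≢ v → adj Γ u w ≡ adj Γ v w

  structEquiv⇒sameNeighbours : ∀ {u v} → StructEquiv Γ u v → SameNeighbours u v
  structEquiv⇒sameNeighbours {u} {v} u∼v w w≢u w≢v =
    trans (sym (u∼v u w)) (cong₂ (adj Γ) (transpose-matchˡ u v) (transpose-fixes w≢u w≢v))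

  sameNeighbours⇒structEquiv : ∀ {u v} → SameNeighbours u v → StructEquiv Γ u v
  sameNeighbours⇒structEquiv {u} {v} same a b
    with transpose u v a | transposition u v a | transpose u v b | transposition u v b
  ... | _ | at-i | _ | at-i = trans (adj-irr Γ v) (sym (adj-irr Γ u))
  ... | _ | at-i | _ | at-j = adj-sym Γ v u
  ... | _ | at-i | _ | fixed b≢u b≢v = sym (same b b≢u b≢v)
  ... | _ | at-j | _ | at-i = adj-sym Γ u v
  ... | _ | at-j | _ | at-j = trans (adj-irr Γ u) (sym (adj-irr Γ v))
  ... | _ | at-j | _ | fixed b≢u b≢v = same b b≢u b≢v
  ... | _ | fixed a≢u a≢v | _ | at-i =
    trans (adj-sym Γ a v) (trans (sym (same a a≢u a≢v)) (adj-sym Γ u a))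
  ... | _ | fixed a≢u a≢v | _ | at-j =
    trans (adj-sym Γ a u) (trans (same a a≢u a≢v) (adj-sym Γ v a))
  ... | _ | fixed _ _ | _ | fixed _ _ = refl

  structEquiv-refl : ∀ u → StructEquiv Γ u u
  structEquiv-refl u = sameNeighbours⇒structEquiv (λ _ _ _ → refl)

  AdjacentToTwins : Fin n → Set
  AdjacentToTwins x = ∀ c → StructEquiv Γ x c → c ≢ x → adj Γ x c ≡ true

  adjacentTwin⇒adjacentToTwins : ∀ {x y} → y ≢ x → StructEquiv Γ x y →
                                 adj Γ x y ≡ true → AdjacentToTwins x
  adjacentTwin⇒adjacentToTwins {x} {y} y≢x x∼y xy-adj c x∼c c≢x with c ≟ y
  ... | yes refl = xy-adj
  ... | no c≢y   = begin
    adj Γ x c ≡⟨ structEquiv⇒sameNeighbours x∼y c c≢x c≢y ⟩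
    adj Γ y c ≡⟨ adj-sym Γ y c ⟩
    adj Γ c y ≡⟨ sym (structEquiv⇒sameNeighbours x∼c y y≢x (c≢y ∘ sym)) ⟩
    adj Γ x y ≡⟨ xy-adj ⟩
    true      ∎
    where open ≡-Reasoning

  adjacentToTwins⇒classComplete : ∀ {x} → AdjacentToTwins x → ClassComplete Γ x
  adjacentToTwins⇒classComplete {x} x-adj a b x∼a x∼b a≢b with a ≟ x | b ≟ x
  ... | yes refl | _        = x-adj b x∼b (a≢b ∘ sym)
  ... | no a≢x   | yes refl = trans (adj-sym Γ a x) (x-adj a x∼a a≢x)
  ... | no a≢x   | no b≢x   =
    trans (sym (structEquiv⇒sameNeighbours x∼a b b≢x (a≢b ∘ sym))) (x-adj b x∼b b≢x)

  samePart⇒sameNeighbours : ∀ {k} (Ω : SkeletalPartition Γ k) {x y} →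
                            part Ω x ≡ part Ω y → SameNeighbours x y
  samePart⇒sameNeighbours Ω {x} {y} x≈y w w≢x w≢y with part Ω w ≟ part Ω x
  ... | no w≉x  = homogeneous Ω x y w w x≈y refl (w≉x ∘ sym)
  ... | yes w≈x = begin
    adj Γ x w ≡⟨ adj-sym Γ x w ⟩
    adj Γ w x ≡⟨ cliqueParts Ω w x w≈x w≢x ⟩
    true      ≡⟨ cliqueParts Ω w y (trans w≈x x≈y) w≢y ⟨
    adj Γ w y ≡⟨ adj-sym Γ w y ⟩
    adj Γ y w ∎
    where open ≡-Reasoning

  module _ {k} (Ω : SkeletalPartition Γ (suc k)) {x y : Fin n}
           (x≉y : part Ω x ≢ part Ω y) (xy-adj : adj Γ x y ≡ true)
           (same : SameNeighbours x y) where

    open Identify x≉y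

    private
      p : Fin n → Fin (suc k)
      p = part Ω

    pair-clique : ∀ z z′ → Pair (p z) → Pair (p z′) → z ≢ z′ → adj Γ z z′ ≡ true
    pair-clique z z′ (inj₁ zx) (inj₁ z′x) z≢z′ = cliqueParts Ω z z′ (trans zx (sym z′x)) z≢z′
    pair-clique z z′ (inj₂ zy) (inj₂ z′y) z≢z′ = cliqueParts Ω z z′ (trans zy (sym z′y)) z≢z′
    pair-clique z z′ (inj₁ zx) (inj₂ z′y) _    =
      trans (sym (homogeneous Ω x z y z′ (sym zx) (sym z′y) x≉y)) xy-adj
    pair-clique z z′ (inj₂ zy) (inj₁ z′x) z≢z′ =
      trans (adj-sym Γ z z′) (pair-clique z′ z (inj₁ z′x) (inj₂ zy) (z≢z′ ∘ sym))

    pair-outside : ∀ z w → Pair (p z) → ¬ Pair (p w) → adj Γ z w ≡ adj Γ x w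
    pair-outside z w (inj₁ zx) w∉ =
      homogeneous Ω z x w w zx refl (λ zw → w∉ (inj₁ (trans (sym zw) zx)))
    pair-outside z w (inj₂ zy) w∉ =
      trans (homogeneous Ω z y w w zy refl (λ zw → w∉ (inj₂ (trans (sym zw) zy))))
            (sym (same w (w∉ ∘ inj₁ ∘ cong p) (w∉ ∘ inj₂ ∘ cong p)))

    merged : Fin n → Fin k
    merged = identify ∘ p

    merged-homogeneousˡ : ∀ z z′ w → merged z ≡ merged z′ → merged z ≢ merged w →
                          adj Γ z w ≡ adj Γ z′ w
    merged-homogeneousˡ z z′ w zz′ zw with identify-kernel (p z) (p z′) zz′
    ... | inj₁ same-part = homogeneous Ω z z′ w w same-part refl (zw ∘ cong identify)
    ... | inj₂ (z∈ , z′∈) =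
      trans (pair-outside z w z∈ w∉) (sym (pair-outside z′ w z′∈ w∉))
      where
      w∉ : ¬ Pair (p w)
      w∉ w∈ = zw (identify-pair z∈ w∈)

    mergeAdjacentTwins : SkeletalPartition Γ k
    mergeAdjacentTwins = record
      { part        = merged
      ; nonempty    = nonempty′
      ; cliqueParts = cliqueParts′
      ; homogeneous = homogeneous′
      }
      where
      nonempty′ : ∀ i → ∃ λ z → merged z ≡ i
      nonempty′ i with nonempty Ω (punchIn (p y) i)
      ... | z , pz = z , trans (cong identify pz) (identify-punchIn i)

      cliqueParts′ : ∀ z z′ → merged z ≡ merged z′ → z ≢ z′ → adj Γ z z′ ≡ true
      cliqueParts′ z z′ zz′ z≢z′ with identify-kernel (p z) (p z′) zz′
      ... | inj₁ same-part  = cliqueParts Ω z z′ same-part z≢z′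
      ... | inj₂ (z∈ , z′∈) = pair-clique z z′ z∈ z′∈ z≢z′

      homogeneous′ : ∀ z z′ w w′ → merged z ≡ merged z′ → merged w ≡ merged w′ →
                     merged z ≢ merged w → adj Γ z w ≡ adj Γ z′ w′
      homogeneous′ z z′ w w′ zz′ ww′ zw = begin
        adj Γ z w   ≡⟨ merged-homogeneousˡ z z′ w zz′ zw ⟩
        adj Γ z′ w  ≡⟨ adj-sym Γ z′ w ⟩
        adj Γ w z′  ≡⟨ merged-homogeneousˡ w w′ z′ ww′ (zw ∘ trans zz′ ∘ sym) ⟩
        adj Γ w′ z′ ≡⟨ adj-sym Γ w′ z′ ⟩
        adj Γ z′ w′ ∎
        where open ≡-Reasoning

  minimal⇒adjacentTwins-samePart : ∀ {k} (Ω : SkeletalPartition Γ k) →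
    IsCompleteSkeleton Γ Ω → ∀ {x y} → SameNeighbours x y → adj Γ x y ≡ true →
    part Ω x ≡ part Ω y
  minimal⇒adjacentTwins-samePart {zero} Ω _ {x} _ _ with part Ω x
  ... | ()
  minimal⇒adjacentTwins-samePart {suc k} Ω minimal {x} {y} same xy-adj
    with part Ω x ≟ part Ω y
  ... | yes x≈y = x≈y
  ... | no x≉y  = contradiction (minimal (mergeAdjacentTwins Ω x≉y xy-adj same)) (1+n≰n)

theorem4p2 : ∀ {n} (Γ : Graph n) {k : ℕ} (Ω : SkeletalPartition Γ k) →
    IsCompleteSkeleton Γ Ω →
    ∀ x y → (part Ω x ≡ part Ω y) ⇔ (x ≡ y ⊎ (StructEquiv Γ x y × ClassComplete Γ x))
theorem4p2 Γ Ω minimal x y = mk⇔ samePart⇒ ⇒samePart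
  where
  samePart⇒ : part Ω x ≡ part Ω y → x ≡ y ⊎ (StructEquiv Γ x y × ClassComplete Γ x)
  samePart⇒ x≈y with x ≟ y
  ... | yes x≡y = inj₁ x≡y
  ... | no x≢y  = inj₂ (x∼y , adjacentToTwins⇒classComplete Γ
                              (adjacentTwin⇒adjacentToTwins Γ (x≢y ∘ sym) x∼y xy-adj))
    where
    x∼y : StructEquiv Γ x y
    x∼y = sameNeighbours⇒structEquiv Γ (samePart⇒sameNeighbours Γ Ω x≈y)
    xy-adj : adj Γ x y ≡ true
    xy-adj = cliqueParts Ω x y x≈y x≢y

  ⇒samePart : x ≡ y ⊎ (StructEquiv Γ x y × ClassComplete Γ x) → part Ω x ≡ part Ω y
  ⇒samePart (inj₁ refl) = refl
  ⇒samePart (inj₂ (x∼y , complete)) with x ≟ y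
  ... | yes refl = refl
  ... | no x≢y   = minimal⇒adjacentTwins-samePart Γ Ω minimal
    (structEquiv⇒sameNeighbours Γ x∼y) (complete x y (structEquiv-refl Γ x) x∼y x≢y)
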